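{- Let $G=(V,E)$ be a hedgegraph and $\mathcal{I}_G=\{F\subseteq E: \text{the hedgegraph }(V,F)\text{ can be trimmed into a forest}\}$. Then $(E,\mathcal{I}_G)$ is a matroid.
   Context: A hedgegraph $G=(V,E)$ consists of a finite vertex set $V$ and a finite set $E$ of hedges; each hedge is a set of hyperedges (subsets of $V$), the hyperedges within one hedge are pairwise vertex-disjoint, and no hyperedge belongs to two hedges. A trimming of a hedge $e$ chooses one hyperedge $h\in e$ and two distinct vertices $u,v\in h$ and replaces $e$ by the edge $\{u,v\}$; a trimming of $(V,F)$ trims every hedge of $F$, yielding a multigraph on $V$ with $|F|$ edges; $(V,F)$ can be trimmed into a forest if some trimming is an acyclic multigraph. -}

module Defs where

open import Data.Nat using (ℕ; suc; _<_)
open import Data.Fin using (Fin; zero; suc; inject₁; fromℕ)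
open import Data.Fin.Subset using (Subset; _∈_; _∉_; _⊆_; _∪_; ⁅_⁆; ∣_∣) renaming (⊥ to ∅)
open import Data.Product using (Σ; _×_; _,_; ∃)
open import Data.Sum using (_⊎_)
open import Data.Empty using (⊥)
open import Relation.Nullary using (¬_)
open import Relation.Binary.PropositionalEquality using (_≡_; _≢_)

-- Since hyperedges
-- are labelled by the hedge they belong to, no hyperedge belongs to two hedges.
record Hedgegraph (n m : ℕ) : Set where
  field
    size     : Fin m → ℕ
    hyp      : (e : Fin m) → Fin (size e) → Subset n
    disjoint : ∀ e (i j : Fin (size e)) → i ≢ j →
               ∀ (x : Fin n) → x ∈ hyp e i → x ∈ hyp e j → ⊥

open Hedgegraph public

record HedgeTrim {n m : ℕ} (G : Hedgegraph n m) (e : Fin m) : Set where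
  constructor trim
  field
    hyperedge : Fin (size G e)
    u v       : Fin n
    u≢v       : u ≢ v
    u∈h       : u ∈ hyp G e hyperedge
    v∈h       : v ∈ hyp G e hyperedge

open HedgeTrim public

Trimming : {n m : ℕ} → Hedgegraph n m → Subset m → Set
Trimming G F = (e : Fin _) → e ∈ F → HedgeTrim G e

Joins : {n : ℕ} → Fin n × Fin n → Fin n → Fin n → Set
Joins (a , b) x y = (a ≡ x × b ≡ y) ⊎ (a ≡ y × b ≡ x)

record Cycle {n m : ℕ} (F : Subset m) (ends : (e : Fin m) → e ∈ F → Fin n × Fin n) : Set where
  field
    k        : ℕ
    es       : Fin (suc k) → Fin m
    inF      : ∀ i → es i ∈ F
    esDist   : ∀ i j → es i ≡ es j → i ≡ j
    ws       : Fin (suc (suc k)) → Fin n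
    closed   : ws zero ≡ ws (fromℕ (suc k))
    wsDist   : ∀ i j → ws (inject₁ i) ≡ ws (inject₁ j) → i ≡ j
    joins    : ∀ i → Joins (ends (es i) (inF i)) (ws (inject₁ i)) (ws (suc i))

Acyclic : {n m : ℕ} (F : Subset m) → ((e : Fin m) → e ∈ F → Fin n × Fin n) → Set
Acyclic F ends = ¬ Cycle F ends

trimEnds : {n m : ℕ} {G : Hedgegraph n m} {F : Subset m} → Trimming G F →
           (e : Fin m) → e ∈ F → Fin n × Fin n
trimEnds t e p = u (t e p) , v (t e p)

TrimmableToForest : {n m : ℕ} → Hedgegraph n m → Subset m → Set
TrimmableToForest G F = Σ (Trimming G F) λ t → Acyclic F (trimEnds t)

record IsMatroid (m : ℕ) (I : Subset m → Set) : Set where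
  field
    empty-indep : I ∅
    down-closed : ∀ A B → B ⊆ A → I A → I B
    augment     : ∀ A B → I A → I B → ∣ A ∣ < ∣ B ∣ →
                  ∃ λ x → x ∈ B × x ∉ A × I (A ∪ ⁅ x ⁆)

-- A hedge acts as a set of candidate edges (two distinct vertices of one of its hyperedges).  Restricting a trimming gives downward closure.
-- For augmentation let tA, tB trim A, B into forests with |A| < |B|.  A graph with k edges on n
-- vertices has at least n − k components and a forest exactly n − k, so tA has more components
-- than tB and some edge of tB, trimming a hedge j ∈ B, joins two components of tA.  Re-trimming j
-- as tB does keeps tA a forest, because the new edge joins two components of the old one.  If
-- j ∉ A this augments A by j; otherwise tA now agrees with tB on one more hedge, and we repeat.

module Submission where

open import Data.Bool using (if_then_else_)
open import Data.Empty using (⊥-elim)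
open import Data.Fin using (Fin; zero; suc; _≟_; fromℕ; inject₁; toℕ)
open import Data.Fin.Properties
  using (0≢1+n; suc-injective; any?; inject₁-injective; toℕ-inject₁; fromℕ≢inject₁)
open import Data.Fin.Subset using (Subset; _∈_; _∉_; _⊆_; _∪_; _-_; ⁅_⁆; ∣_∣; inside; outside) renaming (⊤ to V)
open import Data.Fin.Subset.Properties
  using ( _∈?_; ∉⊥; drop-there; x∈p∪q⁺; x∈p∪q⁻; p⊆p∪q; q⊆p∪q; x∈⁅x⁆; x∈⁅y⁆⇒x≡y; x∈p∧x≢y⇒x∈p-y; p─q⊆p
        ; x∈p⇒∣p-x∣<∣p∣; p⊆q⇒∣p∣≤∣q∣; ∣⁅x⁆∣≡1; ∣⊤∣≡n; ∣p∣≤n)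
open import Data.Maybe using (Maybe; just; nothing)
open import Data.Maybe.Properties using (just-injective) renaming (≡-dec to ≡-dec-Maybe)
open import Data.Nat using (ℕ; zero; suc; _+_; _≤_; _<_; z≤n; s≤s)
open import Data.Nat.Properties
  using ( module ≤-Reasoning; ≤-refl; ≤-trans; ≤-reflexive; <-irrefl; <-asym; ≤-<-trans; <-≤-trans
        ; +-suc; +-comm; +-identityʳ; +-monoˡ-≤; +-monoʳ-≤; +-monoʳ-<; n≤1+n)
open import Data.Product using (Σ; ∃; ∃₂; _×_; _,_; proj₁; proj₂)
open import Data.Product.Properties using () renaming (≡-dec to ≡-dec-×)
open import Data.Sum using (_⊎_; inj₁; inj₂; [_,_])
open import Data.Unit using (⊤; tt)
open import Data.Vec using ([]; _∷_; here; there; tabulate)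
open import Data.Vec.Properties using (lookup∘tabulate; lookup⇒[]=; []=⇒lookup)
open import Data.Vec.Properties.WithK using ([]=-irrelevant)
open import Function using (id; _∘_)
open import Function.Definitions using (Injective)
open import Relation.Binary.Construct.Closure.ReflexiveTransitive using (Star; ε; _◅_; _◅◅_; fold; map)
open import Relation.Binary.Definitions using (DecidableEquality)
open import Relation.Binary.PropositionalEquality
  using (_≡_; _≢_; refl; sym; trans; cong; subst; subst₂; module ≡-Reasoning)
open import Relation.Nullary using (Dec; yes; no; does; ¬?)
open import Relation.Nullary.Decidable using (dec-true; decidable-stable)
open import Relation.Unary using (Pred; Decidable)

open import Defs

∣p∪q∣≤∣p∣+∣q∣ : ∀ {n} (p q : Subset n) → ∣ p ∪ q ∣ ≤ ∣ p ∣ + ∣ q ∣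
∣p∪q∣≤∣p∣+∣q∣ []            []            = z≤n
∣p∪q∣≤∣p∣+∣q∣ (outside ∷ p) (outside ∷ q) = ∣p∪q∣≤∣p∣+∣q∣ p q
∣p∪q∣≤∣p∣+∣q∣ (outside ∷ p) (inside ∷ q)  =
  ≤-trans (s≤s (∣p∪q∣≤∣p∣+∣q∣ p q)) (≤-reflexive (sym (+-suc ∣ p ∣ ∣ q ∣)))
∣p∪q∣≤∣p∣+∣q∣ (inside ∷ p)  (outside ∷ q) = s≤s (∣p∪q∣≤∣p∣+∣q∣ p q)
∣p∪q∣≤∣p∣+∣q∣ (inside ∷ p)  (inside ∷ q)  =
  s≤s (≤-trans (∣p∪q∣≤∣p∣+∣q∣ p q) (+-monoʳ-≤ ∣ p ∣ (n≤1+n ∣ q ∣)))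

∣p∣≤1+∣p-x∣ : ∀ {n} (p : Subset n) (x : Fin n) → ∣ p ∣ ≤ suc ∣ p - x ∣
∣p∣≤1+∣p-x∣ p x = ≤-trans (p⊆q⇒∣p∣≤∣q∣ p⊆p-x∪x) (≤-trans (∣p∪q∣≤∣p∣+∣q∣ (p - x) ⁅ x ⁆) ∣p-x∣+1≤1+∣p-x∣)
  where
  p⊆p-x∪x : p ⊆ (p - x) ∪ ⁅ x ⁆
  p⊆p-x∪x {y} y∈p with y ≟ x
  ... | yes refl = x∈p∪q⁺ (inj₂ (x∈⁅x⁆ x))
  ... | no y≢x   = x∈p∪q⁺ (inj₁ (x∈p∧x≢y⇒x∈p-y y∈p y≢x))
  ∣p-x∣+1≤1+∣p-x∣ : ∣ p - x ∣ + ∣ ⁅ x ⁆ ∣ ≤ suc ∣ p - x ∣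
  ∣p-x∣+1≤1+∣p-x∣ rewrite ∣⁅x⁆∣≡1 x = ≤-reflexive (+-comm ∣ p - x ∣ 1)

x∈p-y⇒x≢y : ∀ {n} {p : Subset n} {x y : Fin n} → x ∈ p - y → x ≢ y
x∈p-y⇒x≢y {p = _ ∷ _} {zero}  {zero}  ()
x∈p-y⇒x≢y {p = _ ∷ _} {zero}  {suc y} _             = 0≢1+n
x∈p-y⇒x≢y {p = _ ∷ _} {suc x} {zero}  _             = 0≢1+n ∘ sym
x∈p-y⇒x≢y {p = _ ∷ _} {suc x} {suc y} (there x∈p-y) = x∈p-y⇒x≢y x∈p-y ∘ suc-injective

injective⇒∣p∣≤∣q∣ : ∀ {a b} {p : Subset a} {q : Subset b} (f : Fin a → Fin b) →
                    (∀ {x} → x ∈ p → f x ∈ q) →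
                    (∀ {x y} → x ∈ p → y ∈ p → f x ≡ f y → x ≡ y) →
                    ∣ p ∣ ≤ ∣ q ∣
injective⇒∣p∣≤∣q∣ {p = []}          f _    _   = z≤n
injective⇒∣p∣≤∣q∣ {p = outside ∷ p} f into inj =
  injective⇒∣p∣≤∣q∣ (f ∘ suc) (into ∘ there) (λ x∈p y∈p → suc-injective ∘ inj (there x∈p) (there y∈p))
injective⇒∣p∣≤∣q∣ {p = inside ∷ p} {q} f into inj =
  ≤-trans (s≤s (injective⇒∣p∣≤∣q∣ (f ∘ suc) into-q-f₀
                 (λ x∈p y∈p → suc-injective ∘ inj (there x∈p) (there y∈p))))
          (x∈p⇒∣p-x∣<∣p∣ (into here))
  where
  into-q-f₀ : ∀ {x} → x ∈ p → f (suc x) ∈ q - f zero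
  into-q-f₀ x∈p = x∈p∧x≢y⇒x∈p-y (into (there x∈p)) (λ eq → 0≢1+n (inj here (there x∈p) (sym eq)))

module _ {n p} {P : Pred (Fin n) p} (P? : Decidable P) where

  satisfying : Subset n
  satisfying = tabulate (does ∘ P?)

  ∈-satisfying⁺ : ∀ {x} → P x → x ∈ satisfying
  ∈-satisfying⁺ {x} px = lookup⇒[]= x satisfying (trans (lookup∘tabulate (does ∘ P?) x) (dec-true (P? x) px))

  ∈-satisfying⁻ : ∀ {x} → x ∈ satisfying → P x
  ∈-satisfying⁻ {x} x∈ with P? x | trans (sym (lookup∘tabulate (does ∘ P?) x)) ([]=⇒lookup x∈)
  ... | yes px | _ = px
  ... | no _   | ()

module _ {a} {A : Set a} (_≟ᴬ_ : DecidableEquality A) {k : ℕ} where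

  differ : (f g : Fin k → A) → Subset k
  differ f g = satisfying (λ e → ¬? (f e ≟ᴬ g e))

  ∣differ∣<-by-fixing : ∀ {f g h : Fin k → A} j → (∀ {e} → e ≢ j → f e ≡ g e) → f j ≡ h j → g j ≢ h j →
                        ∣ differ f h ∣ < ∣ differ g h ∣
  ∣differ∣<-by-fixing {f} {g} {h} j agree fj≡hj gj≢hj =
    ≤-<-trans (p⊆q⇒∣p∣≤∣q∣ differ-f⊆differ-g-j) (x∈p⇒∣p-x∣<∣p∣ (∈-satisfying⁺ (λ e → ¬? (g e ≟ᴬ h e)) gj≢hj))
    where
    differ-f⊆differ-g-j : differ f h ⊆ differ g h - j
    differ-f⊆differ-g-j {e} e∈ = x∈p∧x≢y⇒x∈p-y (∈-satisfying⁺ (λ e → ¬? (g e ≟ᴬ h e)) ge≢he) e≢j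
      where
      fe≢he : f e ≢ h e
      fe≢he = ∈-satisfying⁻ (λ e → ¬? (f e ≟ᴬ h e)) e∈
      e≢j : e ≢ j
      e≢j refl = fe≢he fj≡hj
      ge≢he : g e ≢ h e
      ge≢he ge≡he = fe≢he (trans (agree e≢j) ge≡he)

inject₁≡suc⇒suc≢inject₁ : ∀ {k} {i i′ : Fin k} → inject₁ i ≡ suc i′ → suc i ≢ inject₁ i′
inject₁≡suc⇒suc≢inject₁ {i = i} {i′} eq eq′ = <-asym i′<i i<i′
  where
  i′<i : toℕ i′ < toℕ i
  i′<i = ≤-reflexive (trans (cong toℕ (sym eq)) (toℕ-inject₁ i))
  i<i′ : toℕ i < toℕ i′
  i<i′ = ≤-reflexive (trans (cong toℕ eq′) (toℕ-inject₁ i′))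

chain-≡ : ∀ {A : Set} {N} (f : Fin (suc N) → A) → (∀ i → f (inject₁ i) ≡ f (suc i)) → f zero ≡ f (fromℕ N)
chain-≡ {N = zero}  f steps = refl
chain-≡ {N = suc N} f steps = trans (steps zero) (chain-≡ (f ∘ suc) (steps ∘ suc))

closed-chain-≡ : ∀ {A : Set} {N} (f : Fin (suc N) → A) (i₀ : Fin N) → f zero ≡ f (fromℕ N) →
                 (∀ i → i ≢ i₀ → f (inject₁ i) ≡ f (suc i)) → f (inject₁ i₀) ≡ f (suc i₀)
closed-chain-≡ {N = suc N} f zero     closed steps =
  trans closed (sym (chain-≡ (f ∘ suc) (λ i → steps (suc i) λ ())))
closed-chain-≡ {N = suc N} f (suc i₀) closed steps =
  closed-chain-≡ (f ∘ suc) i₀ (trans (sym (steps zero λ ())) closed)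
                 (λ i i≢i₀ → steps (suc i) (i≢i₀ ∘ suc-injective))

module Multigraph (n : ℕ) where

  Edge : Set
  Edge = Fin n × Fin n

  -- Edges are labelled by their slot in Fin k; nothing marks an empty slot.
  Graph : ℕ → Set
  Graph k = Fin k → Maybe Edge

  Idempotent : (Fin n → Fin n) → Set
  Idempotent r = ∀ x → r (r x) ≡ r x

  redirect : Fin n → Fin n → Fin n → Fin n
  redirect old new z = if does (z ≟ old) then new else z

  redirect-old : ∀ {old new z} → z ≡ old → redirect old new z ≡ new
  redirect-old {old} {new} {z} z≡old with z ≟ old
  ... | yes _      = refl
  ... | no  z≢old  = ⊥-elim (z≢old z≡old)

  redirect-other : ∀ {old new z} → z ≢ old → redirect old new z ≡ z
  redirect-other {old} {new} {z} z≢old with z ≟ old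
  ... | yes z≡old = ⊥-elim (z≢old z≡old)
  ... | no  _     = refl

  redirect-to-new : ∀ old new → redirect old new new ≡ new
  redirect-to-new old new with new ≟ old
  ... | yes _ = refl
  ... | no  _ = refl

  redirect-≡-cases : ∀ {old new z w} → redirect old new z ≡ redirect old new w →
                     z ≡ w ⊎ (z ≡ old × new ≡ w) ⊎ (new ≡ z × w ≡ old)
  redirect-≡-cases {old} {new} {z} {w} eq with z ≟ old | w ≟ old
  ... | yes z≡old | yes w≡old = inj₁ (trans z≡old (sym w≡old))
  ... | yes z≡old | no  _     = inj₂ (inj₁ (z≡old , eq))
  ... | no  _     | yes w≡old = inj₂ (inj₂ (sym eq , w≡old))
  ... | no  _     | no  _     = inj₁ eq

  merge : (Fin n → Fin n) → Edge → Fin n → Fin n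
  merge r (a , b) = redirect (r b) (r a) ∘ r

  addEdge : Maybe Edge → (Fin n → Fin n) → Fin n → Fin n
  addEdge nothing  r = r
  addEdge (just e) r = merge r e

  -- A representative of each vertex's component, built union–find style by merging along the
  -- edges one at a time, slot zero last.
  rep : ∀ {k} → Graph k → Fin n → Fin n
  rep {zero}  E = id
  rep {suc k} E = addEdge (E zero) (rep (E ∘ suc))

  merge-∘-rep : ∀ r e → Idempotent r → ∀ x → merge r e (r x) ≡ merge r e x
  merge-∘-rep r (a , b) r-idem x = cong (redirect (r b) (r a)) (r-idem x)

  merge-idempotent : ∀ r e → Idempotent r → Idempotent (merge r e)
  merge-idempotent r e@(a , b) r-idem x = by-cases (r x ≟ r b)
    where
    open ≡-Reasoning
    by-cases : Dec (r x ≡ r b) → merge r e (merge r e x) ≡ merge r e x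
    by-cases (yes rx≡rb) = begin
      merge r e (merge r e x)    ≡⟨ cong (merge r e) (redirect-old rx≡rb) ⟩
      merge r e (r a)            ≡⟨ merge-∘-rep r e r-idem a ⟩
      redirect (r b) (r a) (r a) ≡⟨ redirect-to-new (r b) (r a) ⟩
      r a                        ≡⟨ sym (redirect-old rx≡rb) ⟩
      merge r e x                ∎
    by-cases (no rx≢rb) = begin
      merge r e (merge r e x) ≡⟨ cong (merge r e) (redirect-other rx≢rb) ⟩
      merge r e (r x)         ≡⟨ merge-∘-rep r e r-idem x ⟩
      merge r e x             ∎

  rep-idempotent : ∀ {k} (E : Graph k) → Idempotent (rep E)
  rep-idempotent {zero}  E x = refl
  rep-idempotent {suc k} E with E zero
  ... | nothing = rep-idempotent (E ∘ suc)
  ... | just e  = merge-idempotent (rep (E ∘ suc)) e (rep-idempotent (E ∘ suc))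

  addEdge-resp : ∀ o r {x y} → r x ≡ r y → addEdge o r x ≡ addEdge o r y
  addEdge-resp nothing        r eq = eq
  addEdge-resp (just (a , b)) r eq = cong (redirect (r b) (r a)) eq

  rep-suc-resp : ∀ {k} (E : Graph (suc k)) {x y} → rep (E ∘ suc) x ≡ rep (E ∘ suc) y → rep E x ≡ rep E y
  rep-suc-resp E = addEdge-resp (E zero) (rep (E ∘ suc))

  rep-edge : ∀ {k} (E : Graph k) j {a b} → E j ≡ just (a , b) → rep E a ≡ rep E b
  rep-edge E zero {a} {b} E₀≡ab rewrite E₀≡ab =
    trans (redirect-to-new (r b) (r a)) (sym (redirect-old {r b} {r a} refl))
    where r = rep (E ∘ suc)
  rep-edge E (suc j) Ej≡ab = rep-suc-resp E (rep-edge (E ∘ suc) j Ej≡ab)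

  Step : ∀ {k} → Graph k → Fin n → Fin n → Set
  Step E x y = ∃₂ λ j e → E j ≡ just e × Joins e x y

  Walk : ∀ {k} → Graph k → Fin n → Fin n → Set
  Walk E = Star (Step E)

  Joins-resp : ∀ {A : Set} (f : Fin n → A) {a b x y} → Joins (a , b) x y → f a ≡ f b → f x ≡ f y
  Joins-resp f (inj₁ (refl , refl)) fa≡fb = fa≡fb
  Joins-resp f (inj₂ (refl , refl)) fa≡fb = sym fa≡fb

  Joins-flip : ∀ {a b x y : Fin n} → Joins (a , b) x y → Joins (x , y) a b
  Joins-flip (inj₁ (refl , refl)) = inj₁ (refl , refl)
  Joins-flip (inj₂ (refl , refl)) = inj₂ (refl , refl)

  Joins-unique : ∀ {e} {x y x′ y′ : Fin n} → Joins e x y → Joins e x′ y′ → (x ≡ x′ × y ≡ y′) ⊎ (x ≡ y′ × y ≡ x′)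
  Joins-unique (inj₁ (refl , refl)) (inj₁ (refl , refl)) = inj₁ (refl , refl)
  Joins-unique (inj₁ (refl , refl)) (inj₂ (refl , refl)) = inj₂ (refl , refl)
  Joins-unique (inj₂ (refl , refl)) (inj₁ (refl , refl)) = inj₂ (refl , refl)
  Joins-unique (inj₂ (refl , refl)) (inj₂ (refl , refl)) = inj₁ (refl , refl)

  walk-resp : ∀ {k} {E : Graph k} {A : Set} (f : Fin n → A) →
              (∀ {j a b} → E j ≡ just (a , b) → f a ≡ f b) →
              ∀ {x y} → Walk E x y → f x ≡ f y
  walk-resp f f-edge =
    fold (λ x y → f x ≡ f y) (λ (_ , _ , Ej≡e , joins) → trans (Joins-resp f joins (f-edge Ej≡e))) refl

  rep≡⇒walk : ∀ {k} (E : Graph k) x y → rep E x ≡ rep E y → Walk E x y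
  rep≡⇒walk {zero}  E x .x refl = ε
  rep≡⇒walk {suc k} E x y = by-edge (E zero) refl
    where
    r = rep (E ∘ suc)
    lift : ∀ {u v} → Walk (E ∘ suc) u v → Walk E u v
    lift = map (λ (j , rest) → suc j , rest)
    walk-tail : ∀ u v → r u ≡ r v → Walk E u v
    walk-tail u v = lift ∘ rep≡⇒walk (E ∘ suc) u v
    by-edge : ∀ o → E zero ≡ o → addEdge o r x ≡ addEdge o r y → Walk E x y
    by-edge nothing        _       = walk-tail x y
    by-edge (just (a , b)) E₀≡ab eq with redirect-≡-cases eq
    ... | inj₁ rx≡ry                 = walk-tail x y rx≡ry
    ... | inj₂ (inj₁ (rx≡rb , ra≡ry)) =
      walk-tail x b rx≡rb ◅◅ (zero , _ , E₀≡ab , inj₂ (refl , refl)) ◅ walk-tail a y ra≡ry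
    ... | inj₂ (inj₂ (ra≡rx , ry≡rb)) =
      walk-tail x a (sym ra≡rx) ◅◅ (zero , _ , E₀≡ab , inj₁ (refl , refl)) ◅ walk-tail b y (sym ry≡rb)

  fixedPoints : (Fin n → Fin n) → Subset n
  fixedPoints r = satisfying (λ x → r x ≟ x)

  ∈-fixedPoints⁺ : ∀ r {x} → r x ≡ x → x ∈ fixedPoints r
  ∈-fixedPoints⁺ r = ∈-satisfying⁺ (λ x → r x ≟ x)

  ∈-fixedPoints⁻ : ∀ r {x} → x ∈ fixedPoints r → r x ≡ x
  ∈-fixedPoints⁻ r = ∈-satisfying⁻ (λ x → r x ≟ x)

  components : ∀ {k} → Graph k → ℕ
  components E = ∣ fixedPoints (rep E) ∣

  module _ (r : Fin n → Fin n) (r-idem : Idempotent r) (a b : Fin n) where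

    private
      r′ = merge r (a , b)

    fixedPoints-merge⊆ : fixedPoints r′ ⊆ fixedPoints r
    fixedPoints-merge⊆ {x} x∈ = ∈-fixedPoints⁺ r (by-cases (r x ≟ r b))
      where
      open ≡-Reasoning
      r′x≡x = ∈-fixedPoints⁻ r′ x∈
      by-cases : Dec (r x ≡ r b) → r x ≡ x
      by-cases (yes rx≡rb) = begin
        r x     ≡⟨ cong r (trans (sym r′x≡x) (redirect-old rx≡rb)) ⟩
        r (r a) ≡⟨ r-idem a ⟩
        r a     ≡⟨ trans (sym (redirect-old rx≡rb)) r′x≡x ⟩
        x       ∎
      by-cases (no rx≢rb) = trans (sym (redirect-other rx≢rb)) r′x≡x

    ⊆fixedPoints-merge : fixedPoints r - r b ⊆ fixedPoints r′
    ⊆fixedPoints-merge {x} x∈ = ∈-fixedPoints⁺ r′ (trans (redirect-other rx≢rb) rx≡x)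
      where
      rx≡x  = ∈-fixedPoints⁻ r (p─q⊆p _ _ x∈)
      rx≢rb = λ rx≡rb → x∈p-y⇒x≢y x∈ (trans (sym rx≡x) rx≡rb)

    fixedPoints-merge⊆-rb : r a ≢ r b → fixedPoints r′ ⊆ fixedPoints r - r b
    fixedPoints-merge⊆-rb ra≢rb {x} x∈ = x∈p∧x≢y⇒x∈p-y (fixedPoints-merge⊆ x∈) x≢rb
      where
      x≢rb : x ≢ r b
      x≢rb refl = ra≢rb (trans (sym (redirect-old (r-idem b))) (∈-fixedPoints⁻ r′ x∈))

    rb∈fixedPoints : r b ∈ fixedPoints r
    rb∈fixedPoints = ∈-fixedPoints⁺ r (r-idem b)

    ∣fixedPoints∣≤1+∣fixedPoints-merge∣ : ∣ fixedPoints r ∣ ≤ suc ∣ fixedPoints r′ ∣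
    ∣fixedPoints∣≤1+∣fixedPoints-merge∣ =
      ≤-trans (∣p∣≤1+∣p-x∣ (fixedPoints r) (r b)) (s≤s (p⊆q⇒∣p∣≤∣q∣ ⊆fixedPoints-merge))

    ∣fixedPoints-merge∣<∣fixedPoints∣ : r a ≢ r b → ∣ fixedPoints r′ ∣ < ∣ fixedPoints r ∣
    ∣fixedPoints-merge∣<∣fixedPoints∣ ra≢rb =
      ≤-<-trans (p⊆q⇒∣p∣≤∣q∣ (fixedPoints-merge⊆-rb ra≢rb)) (x∈p⇒∣p-x∣<∣p∣ rb∈fixedPoints)

  edgeCount : ∀ {k} → Graph k → ℕ
  edgeCount {zero}  E = 0
  edgeCount {suc k} E with E zero
  ... | just _  = suc (edgeCount (E ∘ suc))
  ... | nothing = edgeCount (E ∘ suc)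

  n≤components+edgeCount : ∀ {k} (E : Graph k) → n ≤ components E + edgeCount E
  n≤components+edgeCount {zero} E = begin
    n                      ≡⟨ sym (∣⊤∣≡n n) ⟩
    ∣ V {n} ∣              ≤⟨ p⊆q⇒∣p∣≤∣q∣ {p = V} (λ _ → ∈-fixedPoints⁺ id refl) ⟩
    ∣ fixedPoints id ∣     ≡⟨ sym (+-identityʳ _) ⟩
    ∣ fixedPoints id ∣ + 0 ∎
    where open ≤-Reasoning
  n≤components+edgeCount {suc k} E with E zero | n≤components+edgeCount (E ∘ suc)
  ... | nothing      | n≤c+e = n≤c+e
  ... | just (a , b) | n≤c+e = begin
    n                                                  ≤⟨ n≤c+e ⟩
    ∣ fixedPoints r ∣ + edgeCount (E ∘ suc)            ≤⟨ +-monoˡ-≤ _ merge-loses-≤1 ⟩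
    suc ∣ fixedPoints r′ ∣ + edgeCount (E ∘ suc)       ≡⟨ sym (+-suc _ _) ⟩
    ∣ fixedPoints r′ ∣ + suc (edgeCount (E ∘ suc))     ∎
    where
    open ≤-Reasoning
    r  = rep (E ∘ suc)
    r′ = merge r (a , b)
    merge-loses-≤1 = ∣fixedPoints∣≤1+∣fixedPoints-merge∣ r (rep-idempotent (E ∘ suc)) a b

  -- Acyclicity as union–find sees it: every edge joins two components of the later edges.
  Forest : ∀ {k} → Graph k → Set
  Forest {zero}  E = ⊤
  Forest {suc k} E = (∀ {a b} → E zero ≡ just (a , b) → rep (E ∘ suc) a ≢ rep (E ∘ suc) b) × Forest (E ∘ suc)

  components+edgeCount≤n : ∀ {k} (E : Graph k) → Forest E → components E + edgeCount E ≤ n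
  components+edgeCount≤n {zero}  E _ = ≤-trans (≤-reflexive (+-identityʳ _)) (∣p∣≤n (fixedPoints id))
  components+edgeCount≤n {suc k} E (separates , forest) with E zero | components+edgeCount≤n (E ∘ suc) forest
  ... | nothing      | c+e≤n = c+e≤n
  ... | just (a , b) | c+e≤n = begin
    ∣ fixedPoints r′ ∣ + suc (edgeCount (E ∘ suc)) ≡⟨ +-suc _ _ ⟩
    suc ∣ fixedPoints r′ ∣ + edgeCount (E ∘ suc)   ≤⟨ +-monoˡ-≤ _ merge-loses-1 ⟩
    ∣ fixedPoints r ∣ + edgeCount (E ∘ suc)        ≤⟨ c+e≤n ⟩
    n                                              ∎
    where
    open ≤-Reasoning
    r  = rep (E ∘ suc)
    r′ = merge r (a , b)
    merge-loses-1 = ∣fixedPoints-merge∣<∣fixedPoints∣ r (rep-idempotent (E ∘ suc)) a b (separates refl)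

  edgeCount≡∣p∣ : ∀ {k} (E : Graph k) (p : Subset k) → (∀ {j} → j ∈ p → ∃ λ e → E j ≡ just e) →
             (∀ {j} → j ∉ p → E j ≡ nothing) → edgeCount E ≡ ∣ p ∣
  edgeCount≡∣p∣ E []            edge none = refl
  edgeCount≡∣p∣ E (inside ∷ p)  edge none with E zero | edge here
  ... | just _ | _ = cong suc (edgeCount≡∣p∣ (E ∘ suc) p (edge ∘ there) (λ j∉p → none (j∉p ∘ drop-there)))
  edgeCount≡∣p∣ E (outside ∷ p) edge none with E zero | none {zero} (λ ())
  ... | nothing | _ = edgeCount≡∣p∣ (E ∘ suc) p (edge ∘ there) (λ j∉p → none (j∉p ∘ drop-there))

  coarser⇒components≤ : ∀ {k l} (E : Graph k) (E′ : Graph l) →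
                        (∀ {x y} → rep E′ x ≡ rep E′ y → rep E x ≡ rep E y) →
                        components E ≤ components E′
  coarser⇒components≤ E E′ coarser = injective⇒∣p∣≤∣q∣ (rep E′)
    (λ {x} _ → ∈-fixedPoints⁺ (rep E′) (rep-idempotent E′ x))
    (λ x∈ y∈ eq → trans (sym (∈-fixedPoints⁻ (rep E) x∈)) (trans (coarser eq) (∈-fixedPoints⁻ (rep E) y∈)))

  Crossing : (Fin n → Fin n) → Maybe Edge → Set
  Crossing r o = ∃₂ λ a b → o ≡ just (a , b) × r a ≢ r b

  crossing? : ∀ r → Decidable (Crossing r)
  crossing? r nothing = no λ ()
  crossing? r (just (a , b)) with r a ≟ r b
  ... | yes ra≡rb = no λ { (_ , _ , refl , ra≢rb) → ra≢rb ra≡rb }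
  ... | no  ra≢rb = yes (a , b , refl , ra≢rb)

  forest-augment : ∀ {k} (E F : Graph k) → Forest F → edgeCount E < edgeCount F → ∃ λ j → Crossing (rep E) (F j)
  forest-augment E F forest edgeCount< with any? (λ j → crossing? (rep E) (F j))
  ... | yes crossing = crossing
  ... | no  none     = ⊥-elim (<-irrefl refl n<n)
    where
    internal : ∀ {j a b} → F j ≡ just (a , b) → rep E a ≡ rep E b
    internal {j} {a} {b} Fj≡ab =
      decidable-stable (rep E a ≟ rep E b) (λ ra≢rb → none (j , a , b , Fj≡ab , ra≢rb))
    E-coarser : ∀ {x y} → rep F x ≡ rep F y → rep E x ≡ rep E y
    E-coarser = walk-resp (rep E) internal ∘ rep≡⇒walk F _ _
    open ≤-Reasoning
    n<n : n < n
    n<n = begin-strict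
      n                          ≤⟨ n≤components+edgeCount E ⟩
      components E + edgeCount E <⟨ +-monoʳ-< (components E) edgeCount< ⟩
      components E + edgeCount F ≤⟨ +-monoˡ-≤ (edgeCount F) (coarser⇒components≤ E F E-coarser) ⟩
      components F + edgeCount F ≤⟨ components+edgeCount≤n F forest ⟩
      n                          ∎

  module _ {k} {E : Graph k} where

    length : ∀ {x y} → Walk E x y → ℕ
    length ε       = 0
    length (_ ◅ w) = suc (length w)

    vertex : ∀ {x y} (w : Walk E x y) → Fin (suc (length w)) → Fin n
    vertex {x} w       zero    = x
    vertex     (_ ◅ w) (suc i) = vertex w i

    label : ∀ {x y} (w : Walk E x y) → Fin (length w) → Fin k
    label ((j , _) ◅ w) zero    = j
    label (_       ◅ w) (suc i) = label w i

    vertex-last : ∀ {x y} (w : Walk E x y) → vertex w (fromℕ (length w)) ≡ y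
    vertex-last ε       = refl
    vertex-last (_ ◅ w) = vertex-last w

    step-at : ∀ {x y} (w : Walk E x y) i →
              ∃ λ e → E (label w i) ≡ just e × Joins e (vertex w (inject₁ i)) (vertex w (suc i))
    step-at ((_ , s) ◅ w) zero    = s
    step-at (_       ◅ w) (suc i) = step-at w i

    suffix : ∀ {x y} (w : Walk E x y) i → Walk E (vertex w i) y
    suffix w       zero    = w
    suffix (_ ◅ w) (suc i) = suffix w i

    Simple : ∀ {x y} → Walk E x y → Set
    Simple ε                 = ⊤
    Simple (_◅_ {x} _ w) = (∀ i → vertex w i ≢ x) × Simple w

    suffix-simple : ∀ {x y} (w : Walk E x y) i → Simple w → Simple (suffix w i)
    suffix-simple w       zero    simple       = simple
    suffix-simple (_ ◅ w) (suc i) (_ , simple) = suffix-simple w i simple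

    loop-erase : ∀ {x y} → Walk E x y → Σ (Walk E x y) Simple
    loop-erase ε = ε , tt
    loop-erase (_◅_ {x} s w) with loop-erase w
    ... | w′ , simple with any? (λ i → vertex w′ i ≟ x)
    ...   | yes (i , refl) = suffix w′ i , suffix-simple w′ i simple
    ...   | no  x∉w′       = s ◅ w′ , (λ i eq → x∉w′ (i , eq)) , simple

    vertex-injective : ∀ {x y} (w : Walk E x y) → Simple w → ∀ {i i′} → vertex w i ≡ vertex w i′ → i ≡ i′
    vertex-injective w       _                  {zero}  {zero}   _  = refl
    vertex-injective (_ ◅ w) (x∉w , _)          {zero}  {suc i′} eq = ⊥-elim (x∉w i′ (sym eq))
    vertex-injective (_ ◅ w) (x∉w , _)          {suc i} {zero}   eq = ⊥-elim (x∉w i eq)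
    vertex-injective (_ ◅ w) (_ , simple)       {suc i} {suc i′} eq = cong suc (vertex-injective w simple eq)

    label-injective : ∀ {x y} (w : Walk E x y) → Simple w → ∀ {i i′} → label w i ≡ label w i′ → i ≡ i′
    label-injective w simple {i} {i′} eq with step-at w i | step-at w i′
    ... | e , Ei≡e , joins | e′ , Ei′≡e′ , joins′
      with Joins-unique (subst (λ e → Joins e _ _) (just-injective (trans (sym Ei≡e) (trans (cong E eq) Ei′≡e′))) joins)
                        joins′
    ... | inj₁ (same , _) = inject₁-injective (vertex-injective w simple same)
    ... | inj₂ (crossed , crossed′) =
      ⊥-elim (inject₁≡suc⇒suc≢inject₁ (vertex-injective w simple crossed) (vertex-injective w simple crossed′))

module Trimmings {n m} (G : Hedgegraph n m) where
  open Multigraph n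

  graphOf : ∀ {F} → Trimming G F → Graph m
  graphOf {F} t e with e ∈? F
  ... | yes e∈F = just (trimEnds t e e∈F)
  ... | no  _   = nothing

  module _ {F} (t : Trimming G F) {e : Fin m} where

    graphOf-∈ : (e∈F : e ∈ F) → graphOf t e ≡ just (trimEnds t e e∈F)
    graphOf-∈ e∈F with e ∈? F
    ... | yes e∈F′ = cong (just ∘ trimEnds t e) ([]=-irrelevant e∈F′ e∈F)
    ... | no  e∉F  = ⊥-elim (e∉F e∈F)

    graphOf-∉ : e ∉ F → graphOf t e ≡ nothing
    graphOf-∉ e∉F with e ∈? F
    ... | yes e∈F = ⊥-elim (e∉F e∈F)
    ... | no  _   = refl

    graphOf-just⇒∈ : ∀ {p} → graphOf t e ≡ just p → e ∈ F
    graphOf-just⇒∈ {p} eq with e ∈? F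
    ... | yes e∈F = e∈F
    graphOf-just⇒∈ {p} () | no _

    trimEnds-graphOf : ∀ {p} → graphOf t e ≡ just p → (e∈F : e ∈ F) → trimEnds t e e∈F ≡ p
    trimEnds-graphOf eq e∈F = just-injective (trans (sym (graphOf-∈ e∈F)) eq)

  graphOf-cong : ∀ {F F′} (t : Trimming G F) (t′ : Trimming G F′) {e} → (e ∈ F → e ∈ F′) → (e ∈ F′ → e ∈ F) →
                 (∀ p p′ → trimEnds t e p ≡ trimEnds t′ e p′) → graphOf t e ≡ graphOf t′ e
  graphOf-cong {F} t t′ {e} to from ends≡ = by-cases (e ∈? F)
    where
    by-cases : Dec (e ∈ F) → graphOf t e ≡ graphOf t′ e
    by-cases (yes e∈F) =
      trans (graphOf-∈ t e∈F) (trans (cong just (ends≡ e∈F (to e∈F))) (sym (graphOf-∈ t′ (to e∈F))))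
    by-cases (no  e∉F) = trans (graphOf-∉ t e∉F) (sym (graphOf-∉ t′ (e∉F ∘ from)))

  edgeCount-graphOf : ∀ {F} (t : Trimming G F) → edgeCount (graphOf t) ≡ ∣ F ∣
  edgeCount-graphOf {F} t = edgeCount≡∣p∣ (graphOf t) F (λ e∈F → _ , graphOf-∈ t e∈F) (graphOf-∉ t)

  module _ {F} (t : Trimming G F) where

    path+edge⇒cycle : ∀ {e₀ a b} → graphOf t e₀ ≡ just (a , b) →
                      ∀ {k} (σ : Fin k → Fin m) → Injective _≡_ _≡_ σ → (∀ j → σ j ≢ e₀) →
                      (w : Walk (graphOf t ∘ σ) a b) → Simple w → Cycle F (trimEnds t)
    path+edge⇒cycle {e₀} {a} {b} e₀≡ab σ σ-injective σ≢e₀ w simple = record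
      { k = length w ; es = es ; inF = inF ; esDist = esDist
      ; ws = ws ; closed = sym (vertex-last w) ; wsDist = wsDist ; joins = joins }
      where
      es : Fin (suc (length w)) → Fin m
      es zero    = e₀
      es (suc i) = σ (label w i)

      ws : Fin (suc (suc (length w))) → Fin n
      ws zero    = b
      ws (suc i) = vertex w i

      inF : ∀ i → es i ∈ F
      inF zero    = graphOf-just⇒∈ t e₀≡ab
      inF (suc i) = graphOf-just⇒∈ t (proj₁ (proj₂ (step-at w i)))

      esDist : ∀ i j → es i ≡ es j → i ≡ j
      esDist zero    zero    _  = refl
      esDist zero    (suc j) eq = ⊥-elim (σ≢e₀ _ (sym eq))
      esDist (suc i) zero    eq = ⊥-elim (σ≢e₀ _ eq)
      esDist (suc i) (suc j) eq = cong suc (label-injective w simple (σ-injective eq))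

      wsDist : ∀ i j → ws (inject₁ i) ≡ ws (inject₁ j) → i ≡ j
      wsDist zero    zero    _  = refl
      wsDist zero    (suc j) eq =
        ⊥-elim (fromℕ≢inject₁ (vertex-injective w simple {i′ = inject₁ j} (trans (vertex-last w) eq)))
      wsDist (suc i) zero    eq =
        ⊥-elim (fromℕ≢inject₁ (vertex-injective w simple {i′ = inject₁ i} (trans (vertex-last w) (sym eq))))
      wsDist (suc i) (suc j) eq =
        cong suc (inject₁-injective (vertex-injective w simple {inject₁ i} {inject₁ j} eq))

      joins : ∀ i → Joins (trimEnds t (es i) (inF i)) (ws (inject₁ i)) (ws (suc i))
      joins zero = subst (λ e → Joins e b a) (sym (trimEnds-graphOf t e₀≡ab (inF zero))) (inj₂ (refl , refl))
      joins (suc i) = let e , σi≡e , joins-e = step-at w i in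
        subst (λ e → Joins e (vertex w (inject₁ i)) (vertex w (suc i)))
              (sym (trimEnds-graphOf t σi≡e (inF (suc i)))) joins-e

    acyclic⇒forest : Acyclic F (trimEnds t) →
                     ∀ {k} (σ : Fin k → Fin m) → Injective _≡_ _≡_ σ → Forest (graphOf t ∘ σ)
    acyclic⇒forest acyclic {zero}  σ σ-injective = tt
    acyclic⇒forest acyclic {suc k} σ σ-injective =
      separates , acyclic⇒forest acyclic (σ ∘ suc) (suc-injective ∘ σ-injective)
      where
      separates : ∀ {a b} → graphOf t (σ zero) ≡ just (a , b) →
                  rep (graphOf t ∘ σ ∘ suc) a ≢ rep (graphOf t ∘ σ ∘ suc) b
      separates {a} {b} σ₀≡ab connected with loop-erase (rep≡⇒walk (graphOf t ∘ σ ∘ suc) a b connected)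
      ... | w , simple = acyclic (path+edge⇒cycle σ₀≡ab (σ ∘ suc) (suc-injective ∘ σ-injective)
                                   (λ j eq → 0≢1+n (σ-injective (sym eq))) w simple)

    cycle-transfer : ∀ {F′} {t′ : Trimming G F′} (c : Cycle F′ (trimEnds t′)) →
                     (∀ i → graphOf t′ (Cycle.es c i) ≡ graphOf t (Cycle.es c i)) → Cycle F (trimEnds t)
    cycle-transfer {t′ = t′} c agree = record
      { k = k ; es = es ; inF = inF′ ; esDist = esDist
      ; ws = ws ; closed = closed ; wsDist = wsDist ; joins = joins′ }
      where
      open Cycle c
      t-edge : ∀ i → graphOf t (es i) ≡ just (trimEnds t′ (es i) (inF i))
      t-edge i = trans (sym (agree i)) (graphOf-∈ t′ (inF i))
      inF′ : ∀ i → es i ∈ F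
      inF′ i = graphOf-just⇒∈ t (t-edge i)
      joins′ : ∀ i → Joins (trimEnds t (es i) (inF′ i)) (ws (inject₁ i)) (ws (suc i))
      joins′ i = subst (λ e → Joins e (ws (inject₁ i)) (ws (suc i)))
                       (sym (trimEnds-graphOf t (t-edge i) (inF′ i))) (joins i)

    -- A cycle through j would consist of j and edges of graphOf t, which would then connect a and b.
    exchange-acyclic : Acyclic F (trimEnds t) → ∀ {F′} (t′ : Trimming G F′) j {a b} →
                       (∀ {e} → e ≢ j → graphOf t′ e ≡ graphOf t e) → graphOf t′ j ≡ just (a , b) →
                       rep (graphOf t) a ≢ rep (graphOf t) b → Acyclic F′ (trimEnds t′)
    exchange-acyclic acyclic t′ j agree t′j≡ab separated c with any? (λ i → Cycle.es c i ≟ j)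
    ... | no  avoids      = acyclic (cycle-transfer c (λ i → agree (avoids ∘ (i ,_))))
    ... | yes (i₀ , refl) =
      separated (Joins-resp r (Joins-flip joins-i₀) (closed-chain-≡ (r ∘ ws) i₀ (cong r closed) steps))
      where
      open Cycle c
      r = rep (graphOf t)
      steps : ∀ i → i ≢ i₀ → r (ws (inject₁ i)) ≡ r (ws (suc i))
      steps i i≢i₀ = Joins-resp r (joins i)
        (rep-edge (graphOf t) (es i) (trans (sym (agree (i≢i₀ ∘ esDist i i₀))) (graphOf-∈ t′ (inF i))))
      joins-i₀ : Joins _ (ws (inject₁ i₀)) (ws (suc i₀))
      joins-i₀ = subst (λ e → Joins e (ws (inject₁ i₀)) (ws (suc i₀)))
                       (trimEnds-graphOf t′ t′j≡ab (inF i₀)) (joins i₀)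

  restrict : ∀ {F F′} → F′ ⊆ F → Trimming G F → Trimming G F′
  restrict F′⊆F t e = t e ∘ F′⊆F

  restrict-acyclic : ∀ {F F′} (F′⊆F : F′ ⊆ F) (t : Trimming G F) →
                     Acyclic F (trimEnds t) → Acyclic F′ (trimEnds (restrict F′⊆F t))
  restrict-acyclic F′⊆F t acyclic c = acyclic (cycle-transfer t c λ i →
    graphOf-cong (restrict F′⊆F t) t F′⊆F (λ _ → Cycle.inF c i) (λ _ _ → cong (trimEnds t _) ([]=-irrelevant _ _)))

  graphOf-restrict : ∀ {F F′} (F′⊆F : F′ ⊆ F) → F ⊆ F′ → (t : Trimming G F) →
                     ∀ e → graphOf (restrict F′⊆F t) e ≡ graphOf t e
  graphOf-restrict F′⊆F F⊆F′ t e =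
    graphOf-cong (restrict F′⊆F t) t F′⊆F F⊆F′ (λ _ _ → cong (trimEnds t e) ([]=-irrelevant _ _))

  module _ {A B} (tA : Trimming G A) (tB : Trimming G B) {j} (j∈B : j ∈ B) where

    private
      ∈A : ∀ {e} → e ∈ A ∪ ⁅ j ⁆ → e ≢ j → e ∈ A
      ∈A e∈ e≢j = [ id , (λ e∈⁅j⁆ → ⊥-elim (e≢j (x∈⁅y⁆⇒x≡y j e∈⁅j⁆))) ] (x∈p∪q⁻ A ⁅ j ⁆ e∈)

    replace : Trimming G (A ∪ ⁅ j ⁆)
    replace e e∈ with e ≟ j
    ... | yes refl = tB e j∈B
    ... | no  e≢j  = tA e (∈A e∈ e≢j)

    graphOf-replace-≢ : ∀ {e} → e ≢ j → graphOf replace e ≡ graphOf tA e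
    graphOf-replace-≢ {e} e≢j = graphOf-cong replace tA (λ e∈ → ∈A e∈ e≢j) (p⊆p∪q ⁅ j ⁆) ends≡
      where
      ends≡ : ∀ p p′ → trimEnds replace e p ≡ trimEnds tA e p′
      ends≡ p p′ with e ≟ j
      ... | yes e≡j = ⊥-elim (e≢j e≡j)
      ... | no  _   = cong (trimEnds tA e) ([]=-irrelevant _ _)

    graphOf-replace-j : graphOf replace j ≡ graphOf tB j
    graphOf-replace-j = graphOf-cong replace tB (λ _ → j∈B) (λ _ → q⊆p∪q A ⁅ j ⁆ (x∈⁅x⁆ j)) ends≡
      where
      ends≡ : ∀ p p′ → trimEnds replace j p ≡ trimEnds tB j p′
      ends≡ p p′ with j ≟ j
      ... | yes refl = cong (trimEnds tB j) ([]=-irrelevant _ _)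
      ... | no  j≢j  = ⊥-elim (j≢j refl)

module Augmentation {n m} (G : Hedgegraph n m) {A B : Subset m}
                    (tB : Trimming G B) (acyclic-B : Acyclic B (trimEnds tB)) (∣A∣<∣B∣ : ∣ A ∣ < ∣ B ∣) where
  open Multigraph n
  open Trimmings G

  Augmentable : Set
  Augmentable = ∃ λ x → x ∈ B × x ∉ A × TrimmableToForest G (A ∪ ⁅ x ⁆)

  _≟ᴱ_ : DecidableEquality (Maybe Edge)
  _≟ᴱ_ = ≡-dec-Maybe (≡-dec-× _≟_ _≟_)

  disagreement : Trimming G A → ℕ
  disagreement tA = ∣ differ _≟ᴱ_ (graphOf tA) (graphOf tB) ∣

  Improvable : Trimming G A → Set
  Improvable tA = ∃ λ tA′ → Acyclic A (trimEnds tA′) × disagreement tA′ < disagreement tA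

  exchange-step : (tA : Trimming G A) → Acyclic A (trimEnds tA) → Augmentable ⊎ Improvable tA
  exchange-step tA acyclic-A
    with j , a , b , Bj≡ab , ra≢rb ←
           forest-augment (graphOf tA) (graphOf tB) (acyclic⇒forest tB acyclic-B id id)
             (subst₂ _<_ (sym (edgeCount-graphOf tA)) (sym (edgeCount-graphOf tB)) ∣A∣<∣B∣)
    = by-membership (j ∈? A)
    where
    j∈B = graphOf-just⇒∈ tB Bj≡ab
    t′  = replace tA tB j∈B
    acyclic-t′ : Acyclic (A ∪ ⁅ j ⁆) (trimEnds t′)
    acyclic-t′ = exchange-acyclic tA acyclic-A t′ j (graphOf-replace-≢ tA tB j∈B)
                   (trans (graphOf-replace-j tA tB j∈B) Bj≡ab) ra≢rb
    by-membership : Dec (j ∈ A) → Augmentable ⊎ Improvable tA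
    by-membership (no  j∉A) = inj₁ (j , j∈B , j∉A , t′ , acyclic-t′)
    by-membership (yes j∈A) = inj₂ (tA′ , restrict-acyclic A⊆A∪j t′ acyclic-t′ , fewer)
      where
      A⊆A∪j = p⊆p∪q ⁅ j ⁆
      A∪j⊆A : A ∪ ⁅ j ⁆ ⊆ A
      A∪j⊆A e∈ = [ id , (λ e∈⁅j⁆ → subst (_∈ A) (sym (x∈⁅y⁆⇒x≡y j e∈⁅j⁆)) j∈A) ] (x∈p∪q⁻ A ⁅ j ⁆ e∈)
      tA′ = restrict A⊆A∪j t′
      fewer = ∣differ∣<-by-fixing _≟ᴱ_ {f = graphOf tA′} {graphOf tA} {graphOf tB} j
                (λ {e} e≢j → trans (graphOf-restrict A⊆A∪j A∪j⊆A t′ e) (graphOf-replace-≢ tA tB j∈B e≢j))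
                (trans (graphOf-restrict A⊆A∪j A∪j⊆A t′ j) (graphOf-replace-j tA tB j∈B))
                (λ Aj≡Bj → ra≢rb (rep-edge (graphOf tA) j (trans Aj≡Bj Bj≡ab)))

  augment-within : ∀ d (tA : Trimming G A) → Acyclic A (trimEnds tA) → disagreement tA < d → Augmentable
  augment-within (suc d) tA acyclic-A (s≤s ≤d) with exchange-step tA acyclic-A
  ... | inj₁ augmentable                  = augmentable
  ... | inj₂ (tA′ , acyclic-A′ , fewer) = augment-within d tA′ acyclic-A′ (<-≤-trans fewer ≤d)

  augment : TrimmableToForest G A → Augmentable
  augment (tA , acyclic-A) = augment-within _ tA acyclic-A ≤-refl

lemma3p1 : (n m : ℕ) (G : Hedgegraph n m) → IsMatroid m (TrimmableToForest G)
lemma3p1 n m G = record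
  { empty-indep = (λ e e∈∅ → ⊥-elim (∉⊥ e∈∅)) , λ c → ∉⊥ (Cycle.inF c zero)
  ; down-closed = λ A B B⊆A (t , acyclic) → restrict B⊆A t , restrict-acyclic B⊆A t acyclic
  ; augment     = λ A B forest-A (tB , acyclic-B) ∣A∣<∣B∣ → Augmentation.augment G tB acyclic-B ∣A∣<∣B∣ forest-A
  }
  where open Trimmings G
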